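{- Let $H$ be a $3$-hypergraph, $\pi$ an acyclic quasigraph in $H$ (with a root fixed in each component of $\pi^*$), and $X\subseteq V(H)$. Suppose $u$ is a bad leaf for $\pi$ and $\sigma=\pi^{(u)}$ is the quasigraph in $H^{(u)}$ obtained from $\pi$ by the switch at $u$. Then: (i) if $\pi$ is anticonnected on $X$ in $H$, then $\sigma$ is anticonnected on $X$ in $H^{(u)}$; (ii) if $\pi$ is connected on $X$, then so is $\sigma$.
   Context: A $3$-hypergraph is a finite hypergraph all of whose hyperedges have size $2$ or $3$. A quasigraph $\pi$ in $H$ assigns to each hyperedge $e$ either a $2$-subset of $e$ or $\emptyset$; $e$ is used if $\pi(e)\ne\emptyset$. $\pi^*$ is the graph on $V(H)$ whose edges are the pairs $\pi(e)$, $e$ used; $\pi$ is acyclic if $\pi^*$ is a forest. In each component of $\pi^*$ a root is chosen and edges are oriented towards the root; a used hyperedge $e$ is associated with $u$ if $u$ is the tail of $\pi(e)$. A vertex $u$ is a bad leaf for $\pi$ if $u$ is a leaf of $\pi^*$, $u$ is incident with exactly three hyperedges of $H$, exactly one of which, $e$, has size $3$, and $e$ is associated with $u$. Then the hyperedges at $u$ are $ua,ub,ucd$ with $\pi(ucd)=\{u,c\}$. The switch at $u$ removes $ua,ub,ucd$ from $H$ and adds hyperedges $uab,uc,ud$, giving $H^{(u)}$; the quasigraph $\pi^{(u)}$ in $H^{(u)}$ has $\pi^{(u)}(uc)=\{u,c\}$, leaves $ud$ and $uab$ unused, and agrees with $\pi$ on all other hyperedges. $\pi$ is connected on $X$ if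 the subgraph of $\pi^*$ induced on $X$ is connected. $\pi$ is anticonnected on $X$ in a hypergraph $H'$ if for every partition $\mathcal R$ of $X$ with at least two classes some hyperedge $f$ of $H'$ meets at least two classes of $\mathcal R$ while $\pi(f)$ lies in one class (possibly $\pi(f)=\emptyset$). -}

module Defs where

open import Data.Nat using (ℕ)
open import Data.Fin using (Fin; _≟_)
open import Data.Fin.Subset using (Subset) renaming (_∈_ to _∈ₛ_)
open import Data.List using (List; []; _∷_; length)
open import Data.List.Membership.Propositional using (_∈_)
open import Data.List.Relation.Unary.Unique.Propositional using (Unique)
open import Data.Maybe using (Maybe; just; nothing)
open import Data.Product using (Σ; ∃; ∃-syntax; _×_; _,_)
open import Data.Sum using (_⊎_)
open import Relation.Nullary using (¬_; yes; no)
open import Relation.Binary.PropositionalEquality using (_≡_; _≢_)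
open import Relation.Binary.Construct.Closure.ReflexiveTransitive using (Star)

-- Vertices are Fin n, hyperedges are indexed by Fin m; a hyperedge is
-- a list of vertices (read as the set of its elements).
Hypergraph : ℕ → ℕ → Set
Hypergraph n m = Fin m → List (Fin n)

Is3Hypergraph : ∀ {n m} → Hypergraph n m → Set
Is3Hypergraph H = ∀ i → Unique (H i) × (length (H i) ≡ 2 ⊎ length (H i) ≡ 3)

_≈ₑ_ : ∀ {n} → List (Fin n) → List (Fin n) → Set
e ≈ₑ f = ∀ x → (x ∈ e → x ∈ f) × (x ∈ f → x ∈ e)

-- A (rooted) quasigraph: each hyperedge is either unused (nothing) or
-- assigned an ordered pair (tail , head) of distinct vertices of the
-- hyperedge; the pair as a set is π(e), the order records the
-- orientation of the edge of π* towards the root of its component.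
Quasigraph : ℕ → ℕ → Set
Quasigraph n m = Fin m → Maybe (Fin n × Fin n)

IsQuasigraph : ∀ {n m} → Hypergraph n m → Quasigraph n m → Set
IsQuasigraph H π = ∀ i x y → π i ≡ just (x , y) → x ≢ y × x ∈ H i × y ∈ H i

Joins : ∀ {n m} → Quasigraph n m → Fin m → Fin n → Fin n → Set
Joins π i x y = π i ≡ just (x , y) ⊎ π i ≡ just (y , x)

AdjWithout : ∀ {n m} → Quasigraph n m → Fin m → Fin n → Fin n → Set
AdjWithout π i x y = ∃[ j ] (j ≢ i × Joins π j x y)

-- π is acyclic: π* (as a multigraph) is a forest, i.e. every edge is a bridge
Acyclic : ∀ {n m} → Quasigraph n m → Set
Acyclic π = ∀ i x y → π i ≡ just (x , y) → ¬ Star (AdjWithout π i) x y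

-- The orientation is towards a root in each component: in a forest this
-- means every vertex is the tail of at most one edge (the root of each
-- component being its unique vertex of out-degree 0).
OrientedToRoots : ∀ {n m} → Quasigraph n m → Set
OrientedToRoots π = ∀ i j x y z → π i ≡ just (x , y) → π j ≡ just (x , z) → i ≡ j

IncidentUsed : ∀ {n m} → Quasigraph n m → Fin m → Fin n → Set
IncidentUsed π i u = ∃[ v ] Joins π i u v

Leaf : ∀ {n m} → Quasigraph n m → Fin n → Set
Leaf π u = ∃[ i ] (IncidentUsed π i u × (∀ j → IncidentUsed π j u → j ≡ i))

-- u is a bad leaf: leaf of π*, incident with exactly three hyperedges
-- (indices e₁ e₂ e₃), exactly one of which (e₃) has size 3, and e₃ is
-- associated with u (u is the tail of π(e₃)).
BadLeaf : ∀ {n m} → Hypergraph n m → Quasigraph n m → Fin n → Set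
BadLeaf H π u =
  Leaf π u ×
  ∃[ e₁ ] ∃[ e₂ ] ∃[ e₃ ]
    ( e₁ ≢ e₂ × e₁ ≢ e₃ × e₂ ≢ e₃
    × u ∈ H e₁ × u ∈ H e₂ × u ∈ H e₃
    × (∀ j → u ∈ H j → j ≡ e₁ ⊎ j ≡ e₂ ⊎ j ≡ e₃)
    × length (H e₁) ≡ 2 × length (H e₂) ≡ 2 × length (H e₃) ≡ 3
    × ∃[ c ] π e₃ ≡ just (u , c))

-- The switch at u, where hyperedge ia = ua, ib = ub, ie = ucd:
-- ia becomes uab, ib becomes ud, ie becomes uc.
switchH : ∀ {n m} → Hypergraph n m → (ia ib ie : Fin m) → (u a b c d : Fin n)
        → Hypergraph n m
switchH H ia ib ie u a b c d j with j ≟ ia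
... | yes _ = u ∷ a ∷ b ∷ []
... | no _ with j ≟ ib
...   | yes _ = u ∷ d ∷ []
...   | no _ with j ≟ ie
...     | yes _ = u ∷ c ∷ []
...     | no _ = H j

switchπ : ∀ {n m} → Quasigraph n m → (ia ib ie : Fin m) → (u c : Fin n)
        → Quasigraph n m
switchπ π ia ib ie u c j with j ≟ ia
... | yes _ = nothing
... | no _ with j ≟ ib
...   | yes _ = nothing
...   | no _ with j ≟ ie
...     | yes _ = just (u , c)
...     | no _ = π j

AdjIn : ∀ {n m} → Quasigraph n m → Subset n → Fin n → Fin n → Set
AdjIn π X x y = x ∈ₛ X × y ∈ₛ X × ∃[ i ] Joins π i x y

ConnectedOn : ∀ {n m} → Quasigraph n m → Subset n → Set
ConnectedOn π X = ∀ x y → x ∈ₛ X → y ∈ₛ X → Star (AdjIn π X) x y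

-- A partition R of X is given by a labelling ρ; its classes are the
-- nonempty fibres ρ⁻¹(k) ∩ X.  It has at least two classes iff two
-- vertices of X get different labels.
AtLeastTwoClasses : ∀ {n} → Subset n → (Fin n → ℕ) → Set
AtLeastTwoClasses X ρ = ∃[ x ] ∃[ y ] (x ∈ₛ X × y ∈ₛ X × ρ x ≢ ρ y)

MeetsTwo : ∀ {n} → Subset n → (Fin n → ℕ) → List (Fin n) → Set
MeetsTwo X ρ f = ∃[ x ] ∃[ y ] (x ∈ f × y ∈ f × x ∈ₛ X × y ∈ₛ X × ρ x ≢ ρ y)

InOneClass : ∀ {n} → Subset n → (Fin n → ℕ) → Maybe (Fin n × Fin n) → Set
InOneClass X ρ p =
  p ≡ nothing ⊎ ∃[ x ] ∃[ y ] (p ≡ just (x , y) × x ∈ₛ X × y ∈ₛ X × ρ x ≡ ρ y)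

AnticonnectedOn : ∀ {n m} → Hypergraph n m → Quasigraph n m → Subset n → Set
AnticonnectedOn {n} H π X =
  ∀ (ρ : Fin n → ℕ) → AtLeastTwoClasses X ρ →
    ∃[ f ] (MeetsTwo X ρ (H f) × InOneClass X ρ (π f))

{-# OPTIONS --safe #-}
-- Since u is a leaf of π* whose only edge comes from ucd, the graph edges ua and ub
-- are unused by π.  Hence σ = π^(u) agrees with π on every index: the switch only
-- changes the hypergraph, and connectivity on X carries over verbatim.  For
-- anticonnectivity, a witness f of π for a partition R gives a witness of σ: if f is
-- ua or ub, then uab contains f and is unused; if f is ucd, then u and c lie in one
-- class, so f can meet two classes only because d is in another class than u, and ud
-- is unused; every other hyperedge is left unchanged.
module Submission where

open import Defs
open import Data.Nat using (ℕ)
open import Data.Fin using (Fin; _≟_)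
open import Data.Fin.Subset using (Subset) renaming (_∈_ to _∈ₛ_)
open import Data.List using (List; []; _∷_)
open import Data.List.Relation.Unary.Any using (here; there)
open import Data.List.Membership.Propositional using (_∈_)
open import Data.List.Relation.Binary.Subset.Propositional using (_⊆_)
open import Data.List.Relation.Binary.Subset.Propositional.Properties
  using (⊆-trans; xs⊆x∷xs; ∷⁺ʳ; xs⊆xs++ys)
open import Data.Maybe using (just; nothing)
open import Data.Product using (_×_; _,_; proj₁; ∃-syntax)
open import Data.Sum using (_⊎_; inj₁; inj₂)
import Data.Sum as Sum
open import Relation.Nullary using (yes; no; contradiction)
open import Relation.Binary.PropositionalEquality
open import Relation.Binary.Construct.Closure.ReflexiveTransitive as Star using ()

≈ₑ⇒⊆ : ∀ {n} {e f : List (Fin n)} → e ≈ₑ f → e ⊆ f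
≈ₑ⇒⊆ e≈f {x} = proj₁ (e≈f x)

distinct-in-pair⇒one-is-first : ∀ {n} {x y u a : Fin n}
  → x ≢ y → x ∈ u ∷ a ∷ [] → y ∈ u ∷ a ∷ [] → x ≡ u ⊎ y ≡ u
distinct-in-pair⇒one-is-first _   (here x≡u)         _                  = inj₁ x≡u
distinct-in-pair⇒one-is-first _   (there _)          (here y≡u)         = inj₂ y≡u
distinct-in-pair⇒one-is-first x≢y (there (here x≡a)) (there (here y≡a)) = contradiction (trans x≡a (sym y≡a)) x≢y

Leaf-unique : ∀ {n m} {π : Quasigraph n m} {u i j}
  → Leaf π u → IncidentUsed π i u → IncidentUsed π j u → i ≡ j
Leaf-unique (_ , _ , only) i∋u j∋u = trans (only _ i∋u) (sym (only _ j∋u))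

module _ {n m} (H : Hypergraph n m) (π : Quasigraph n m) where

  unused-at-leaf : ∀ {u a c} {ie k} → IsQuasigraph H π → Leaf π u → π ie ≡ just (u , c)
    → k ≢ ie → H k ⊆ u ∷ a ∷ [] → π k ≡ nothing
  unused-at-leaf {u} {k = k} qπ leaf πie k≢ie Hk⊆ua with π k in πk
  ... | nothing = refl
  ... | just (x , y) = contradiction (Leaf-unique leaf k∋u (_ , inj₁ πie)) k≢ie
    where
    k∋u : IncidentUsed π k u
    k∋u with x≢y , x∈ , y∈ ← qπ k x y πk
        with distinct-in-pair⇒one-is-first x≢y (Hk⊆ua x∈) (Hk⊆ua y∈)
    ... | inj₁ refl = y , inj₁ πk
    ... | inj₂ refl = x , inj₂ πk

module _ {n} (X : Subset n) (ρ : Fin n → ℕ) where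

  MeetsTwo-mono : ∀ {e f} → e ⊆ f → MeetsTwo X ρ e → MeetsTwo X ρ f
  MeetsTwo-mono e⊆f (x , y , x∈ , y∈ , rest) = x , y , e⊆f x∈ , e⊆f y∈ , rest

  representative-after-merge : ∀ {u c f z} → u ∈ₛ X → ρ u ≡ ρ c → z ∈ u ∷ c ∷ f → z ∈ₛ X
    → ∃[ z′ ] (z′ ∈ u ∷ f × z′ ∈ₛ X × ρ z′ ≡ ρ z)
  representative-after-merge {u} _  _      (here refl)         zX = u , here refl , zX , refl
  representative-after-merge {u} uX ρu≡ρc (there (here refl)) _  = u , here refl , uX , ρu≡ρc
  representative-after-merge     _  _      (there (there z∈))  zX = _ , there z∈ , zX , refl

  MeetsTwo-merge : ∀ {u c f} → u ∈ₛ X → ρ u ≡ ρ c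
    → MeetsTwo X ρ (u ∷ c ∷ f) → MeetsTwo X ρ (u ∷ f)
  MeetsTwo-merge uX ρu≡ρc (x , y , x∈ , y∈ , xX , yX , ρx≢ρy)
    with x′ , x′∈ , x′X , ρx′≡ρx ← representative-after-merge uX ρu≡ρc x∈ xX
       | y′ , y′∈ , y′X , ρy′≡ρy ← representative-after-merge uX ρu≡ρc y∈ yX
    = x′ , y′ , x′∈ , y′∈ , x′X , y′X , λ ρx′≡ρy′ → ρx≢ρy (begin
        ρ x  ≡⟨ ρx′≡ρx ⟨
        ρ x′ ≡⟨ ρx′≡ρy′ ⟩
        ρ y′ ≡⟨ ρy′≡ρy ⟩
        ρ y  ∎)
    where open ≡-Reasoning

  InOneClass-just : ∀ {x y} → InOneClass X ρ (just (x , y)) → x ∈ₛ X × y ∈ₛ X × ρ x ≡ ρ y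
  InOneClass-just (inj₂ (_ , _ , refl , xX , yX , ρx≡ρy)) = xX , yX , ρx≡ρy

ConnectedOn-resp-≗ : ∀ {n m} {π σ : Quasigraph n m} {X : Subset n}
  → (∀ j → σ j ≡ π j) → ConnectedOn π X → ConnectedOn σ X
ConnectedOn-resp-≗ σ≗π conn x y xX yX = Star.map adj (conn x y xX yX)
  where
  adj : ∀ {p q} → AdjIn _ _ p q → AdjIn _ _ p q
  adj (pX , qX , j , joins) = pX , qX , j , Sum.map (trans (σ≗π j)) (trans (σ≗π j)) joins

module _ {n m} (H : Hypergraph n m) (ia ib ie : Fin m) (u a b c d : Fin n) where

  switchH-ia : switchH H ia ib ie u a b c d ia ≡ u ∷ a ∷ b ∷ []
  switchH-ia with ia ≟ ia
  ... | yes _   = refl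
  ... | no ia≢ia = contradiction refl ia≢ia

  switchH-ib : ia ≢ ib → switchH H ia ib ie u a b c d ib ≡ u ∷ d ∷ []
  switchH-ib ia≢ib with ib ≟ ia
  ... | yes ib≡ia = contradiction (sym ib≡ia) ia≢ib
  ... | no _ with ib ≟ ib
  ...   | yes _    = refl
  ...   | no ib≢ib = contradiction refl ib≢ib

  switchH-other : ∀ {j} → j ≢ ia → j ≢ ib → j ≢ ie → switchH H ia ib ie u a b c d j ≡ H j
  switchH-other {j} j≢ia j≢ib j≢ie with j ≟ ia
  ... | yes j≡ia = contradiction j≡ia j≢ia
  ... | no _ with j ≟ ib
  ...   | yes j≡ib = contradiction j≡ib j≢ib
  ...   | no _ with j ≟ ie
  ...     | yes j≡ie = contradiction j≡ie j≢ie
  ...     | no _     = refl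

switchπ-≗ : ∀ {n m} (π : Quasigraph n m) {ia ib ie : Fin m} {u c : Fin n}
  → π ia ≡ nothing → π ib ≡ nothing → π ie ≡ just (u , c)
  → ∀ j → switchπ π ia ib ie u c j ≡ π j
switchπ-≗ π {ia} {ib} {ie} πia πib πie j with j ≟ ia
... | yes refl = sym πia
... | no _ with j ≟ ib
...   | yes refl = sym πib
...   | no _ with j ≟ ie
...     | yes refl = sym πie
...     | no _     = refl

module _ {n m} (H : Hypergraph n m) (π : Quasigraph n m) (X : Subset n)
         {ia ib ie : Fin m} {u a b c d : Fin n} (ia≢ib : ia ≢ ib)
         (Ha⊆ : H ia ⊆ u ∷ a ∷ []) (Hb⊆ : H ib ⊆ u ∷ b ∷ []) (He⊆ : H ie ⊆ u ∷ c ∷ d ∷ [])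
         (πia : π ia ≡ nothing) (πib : π ib ≡ nothing) (πie : π ie ≡ just (u , c)) where

  private
    H′ : Hypergraph n m
    H′ = switchH H ia ib ie u a b c d

    σ : Quasigraph n m
    σ = switchπ π ia ib ie u c

    WitnessAfterSwitch : (Fin n → ℕ) → Set
    WitnessAfterSwitch ρ = ∃[ f′ ] (MeetsTwo X ρ (H′ f′) × InOneClass X ρ (σ f′))

    uab-witness : ∀ {ρ} → MeetsTwo X ρ (u ∷ a ∷ b ∷ []) → WitnessAfterSwitch ρ
    uab-witness {ρ} meets = ia , subst (MeetsTwo X ρ) (sym (switchH-ia H ia ib ie u a b c d)) meets
                               , inj₁ (trans (switchπ-≗ π πia πib πie ia) πia)

    ud-witness : ∀ {ρ} → MeetsTwo X ρ (u ∷ d ∷ []) → WitnessAfterSwitch ρ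
    ud-witness {ρ} meets = ib , subst (MeetsTwo X ρ) (sym (switchH-ib H ia ib ie u a b c d ia≢ib)) meets
                              , inj₁ (trans (switchπ-≗ π πia πib πie ib) πib)

    switch-transfers-witness : ∀ ρ f → MeetsTwo X ρ (H f) → InOneClass X ρ (π f) → WitnessAfterSwitch ρ
    switch-transfers-witness ρ f meets oneClass with f ≟ ia | f ≟ ib | f ≟ ie
    ... | yes refl | _        | _        = uab-witness (MeetsTwo-mono X ρ (⊆-trans Ha⊆ (xs⊆xs++ys _ _)) meets)
    ... | no _     | yes refl | _        = uab-witness (MeetsTwo-mono X ρ (⊆-trans Hb⊆ (∷⁺ʳ u (xs⊆x∷xs _ a))) meets)
    ... | no _     | no _     | yes refl =
      let uX , _ , ρu≡ρc = InOneClass-just X ρ (subst (InOneClass X ρ) πie oneClass)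
      in  ud-witness (MeetsTwo-merge X ρ uX ρu≡ρc (MeetsTwo-mono X ρ He⊆ meets))
    ... | no f≢ia  | no f≢ib  | no f≢ie  =
      f , subst (MeetsTwo X ρ) (sym (switchH-other H ia ib ie u a b c d f≢ia f≢ib f≢ie)) meets
        , subst (InOneClass X ρ) (sym (switchπ-≗ π πia πib πie f)) oneClass

  switch-preserves-anticonnected : AnticonnectedOn H π X → AnticonnectedOn H′ σ X
  switch-preserves-anticonnected anti ρ two with f , meets , oneClass ← anti ρ two =
    switch-transfers-witness ρ f meets oneClass

lemma14 : ∀ {n m} (H : Hypergraph n m) (π : Quasigraph n m) (X : Subset n) (u : Fin n)
          → Is3Hypergraph H → IsQuasigraph H π → Acyclic π → OrientedToRoots π
          → BadLeaf H π u
          → ∀ (ia ib ie : Fin m) (a b c d : Fin n)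
          → ia ≢ ib → ia ≢ ie → ib ≢ ie
          → H ia ≈ₑ (u ∷ a ∷ []) → H ib ≈ₑ (u ∷ b ∷ []) → H ie ≈ₑ (u ∷ c ∷ d ∷ [])
          → π ie ≡ just (u , c)
          → (AnticonnectedOn H π X
               → AnticonnectedOn (switchH H ia ib ie u a b c d) (switchπ π ia ib ie u c) X)
            × (ConnectedOn π X → ConnectedOn (switchπ π ia ib ie u c) X)
lemma14 H π X u _ isQuasi _ _ (leaf , _) ia ib ie a b c d ia≢ib ia≢ie ib≢ie Ha Hb He πie =
    switch-preserves-anticonnected H π X ia≢ib (≈ₑ⇒⊆ Ha) (≈ₑ⇒⊆ Hb) (≈ₑ⇒⊆ He) πia πib πie
  , ConnectedOn-resp-≗ (switchπ-≗ π πia πib πie)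
  where
  πia : π ia ≡ nothing
  πia = unused-at-leaf H π isQuasi leaf πie ia≢ie (≈ₑ⇒⊆ Ha)

  πib : π ib ≡ nothing
  πib = unused-at-leaf H π isQuasi leaf πie ib≢ie (≈ₑ⇒⊆ Hb)
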